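{- Let $A$ and $B$ be nonempty sorted sequences of elements from a totally ordered set. Any (deterministic, comparison-based) algorithm that merges $A$ and $B$, i.e., determines the sorted order of $A\cup B$, has fragile complexity at least $\lfloor\log_2|A|\rfloor+1$: there is an input on which some element participates in at least $\lfloor\log_2|A|\rfloor+1$ comparisons.
   Context: Elements are accessed only through comparisons; the fragile complexity of an algorithm is the maximum number of comparisons any single element participates in. -}

module Defs where

open import Data.Nat using (ℕ; zero; suc; _+_; _<_; _<ᵇ_)
open import Data.Fin as Fin using (Fin)
open import Data.Sum using (_⊎_; inj₁; inj₂)
open import Data.Sum.Properties using (≡-dec)
open import Data.Bool using (Bool; true; false; if_then_else_; _∨_)
open import Data.List using (List)
open import Data.List.Membership.Propositional using (_∈_)
open import Data.List.Relation.Unary.Linked using (Linked)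
open import Relation.Nullary using (does)
open import Relation.Binary.PropositionalEquality using (_≡_; _≢_)

-- The elements of the merging instance: inj₁ i is a_i (i-th element of A),
-- inj₂ j is b_j (j-th element of B).  |A| = m, |B| = n.
Elem : ℕ → ℕ → Set
Elem m n = Fin m ⊎ Fin n

_≟ₑ_ : ∀ {m n} (x y : Elem m n) → Bool
x ≟ₑ y = does (≡-dec Fin._≟_ Fin._≟_ x y)

record Input (m n : ℕ) : Set where
  field
    valA    : Fin m → ℕ
    valB    : Fin n → ℕ
    sortedA : ∀ i j → i Fin.< j → valA i < valA j
    sortedB : ∀ i j → i Fin.< j → valB i < valB j
    distinct : ∀ i j → valA i ≢ valB j

val : ∀ {m n} → Input m n → Elem m n → ℕ
val I (inj₁ i) = Input.valA I i
val I (inj₂ j) = Input.valB I j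

-- A deterministic comparison-based algorithm = a decision tree.
-- cmp x y l r : compare elements x and y; continue with l if x < y,
-- otherwise with r.  A leaf outputs a claimed sorted order of A ∪ B.
data Tree (m n : ℕ) : Set where
  leaf : List (Elem m n) → Tree m n
  cmp  : Elem m n → Elem m n → Tree m n → Tree m n → Tree m n

run : ∀ {m n} → Tree m n → (Elem m n → ℕ) → List (Elem m n)
run (leaf o)      v = o
run (cmp x y l r) v = if v x <ᵇ v y then run l v else run r v

cost : ∀ {m n} → Tree m n → (Elem m n → ℕ) → Elem m n → ℕ
cost (leaf _)      v e = 0
cost (cmp x y l r) v e =
  (if (e ≟ₑ x) ∨ (e ≟ₑ y) then 1 else 0)
  + (if v x <ᵇ v y then cost l v e else cost r v e)

IsSortedOrder : ∀ {m n} → (Elem m n → ℕ) → List (Elem m n) → Set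
IsSortedOrder v o = Linked (λ x y → v x < v y) o × (∀ e → e ∈ o)
  where open import Data.Product using (_×_)

Merges : ∀ {m n} → Tree m n → Set
Merges {m} {n} t = ∀ (I : Input m n) → IsSortedOrder (val I) (run t (val I))

-- Adversary argument.  Fix A and all of B except b₀, and let b₀ range over
-- the |A| + 1 gaps of A (input k puts b₀ just below a_k).  A comparison not
-- involving b₀ has the same outcome on all these inputs; one involving b₀
-- splits any interval of gaps into a lower and an upper part.  Descending
-- the tree and always keeping the larger part, the surviving interval still
-- has at least (|A| + 1) / 2^c gaps after c comparisons involving b₀.
-- A leaf serves at most one gap, since the sorted orders for adjacent gaps
-- differ in the order of b₀ and a_k; so some input makes b₀ take part in at
-- least log₂ (|A| + 1) comparisons.
module Submission where

open import Defs
open import Data.Nat using (ℕ; _+_; _≤_)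
open import Data.Nat.Logarithm using (⌊log₂_⌋)
open import Data.Product using (∃; ∃-syntax; _×_)
open import Data.Nat
  using (zero; suc; z<s; _*_; _<_; _<ᵇ_; _^_; _∸_; ⌊_/2⌋; z≤n; s≤s; _<?_)
open import Data.Nat.Properties
open import Data.Nat.Logarithm.Core using (⌊log2⌋)
open import Data.Nat.Induction using (<-wellFounded)
open import Induction.WellFounded using (Acc; acc)
open import Data.Fin as Fin using (toℕ; fromℕ<)
open import Data.Fin.Properties using (toℕ-fromℕ<)
open import Data.Sum using (_⊎_; inj₁; inj₂)
open import Data.Bool using (Bool; true; false; if_then_else_; _∨_)
open import Data.Bool.Properties using (T-≡; ¬-not)
open import Data.Product using (_,_)
open import Data.List using (List)
open import Data.List.Membership.Propositional using (_∈_)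
open import Data.List.Relation.Unary.Any using (here; there)
open import Data.List.Relation.Unary.All as All using ()
open import Data.List.Relation.Unary.AllPairs using (AllPairs; _∷_)
open import Data.List.Relation.Unary.Linked as Linked using ()
open import Data.List.Relation.Unary.Linked.Properties using (Linked⇒AllPairs)
open import Data.Empty using (⊥; ⊥-elim)
open import Function using (_on_; Equivalence)
open import Relation.Nullary using (yes; no; contradiction)
open import Relation.Binary.PropositionalEquality

private variable
  m n k lo hi c : ℕ

<ᵇ≡true : m < n → (m <ᵇ n) ≡ true
<ᵇ≡true m<n = Equivalence.to T-≡ (<⇒<ᵇ m<n)

<ᵇ≡false : n ≤ m → (m <ᵇ n) ≡ false
<ᵇ≡false {n} {m} n≤m = ¬-not λ m<ᵇn → <⇒≱ (<ᵇ⇒< m n (Equivalence.from T-≡ m<ᵇn)) n≤m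

2*⌊n/2⌋≤n : ∀ n → 2 * ⌊ n /2⌋ ≤ n
2*⌊n/2⌋≤n 0             = z≤n
2*⌊n/2⌋≤n 1             = z≤n
2*⌊n/2⌋≤n (suc (suc n)) =
  subst (_≤ suc (suc n)) (sym (*-suc 2 ⌊ n /2⌋)) (s≤s (s≤s (2*⌊n/2⌋≤n n)))

2^⌊log2⌋≤n : ∀ n (rec : Acc _<_ (suc n)) → 2 ^ ⌊log2⌋ (suc n) rec ≤ suc n
2^⌊log2⌋≤n zero    _        = ≤-refl
2^⌊log2⌋≤n (suc n) (acc rs) = ≤-trans
  (*-monoʳ-≤ 2 (2^⌊log2⌋≤n ⌊ n /2⌋ (rs (⌊n/2⌋<n (suc n)))))
  (2*⌊n/2⌋≤n (suc (suc n)))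

<2^⇒⌊log₂⌋< : suc n < 2 ^ c → ⌊log₂ suc n ⌋ < c
<2^⇒⌊log₂⌋< {n} {c} n<2^c with ⌊log₂ suc n ⌋ <? c
... | yes log<c = log<c
... | no  log≮c = contradiction
  (≤-trans (^-monoʳ-≤ 2 (≮⇒≥ log≮c)) (2^⌊log2⌋≤n n (<-wellFounded (suc n))))
  (<⇒≱ n<2^c)

∸-split : lo ≤ c → c ≤ hi → hi ∸ lo ≡ (c ∸ lo) + (hi ∸ c)
∸-split {lo} {c} {hi} lo≤c c≤hi = begin
  hi ∸ lo              ≡⟨ cong (_∸ lo) (sym (m+[n∸m]≡n c≤hi)) ⟩
  c + (hi ∸ c) ∸ lo    ≡⟨ +-∸-comm (hi ∸ c) lo≤c ⟩
  (c ∸ lo) + (hi ∸ c)  ∎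
  where open ≡-Reasoning

m+n≤2*m⊎m+n≤2*n : ∀ m n → m + n ≤ 2 * m ⊎ m + n ≤ 2 * n
m+n≤2*m⊎m+n≤2*n m n with ≤-total m n
... | inj₁ m≤n = inj₂ (subst (m + n ≤_) (cong (n +_) (sym (+-identityʳ n))) (+-monoˡ-≤ n m≤n))
... | inj₂ n≤m = inj₁ (subst (m + n ≤_) (cong (m +_) (sym (+-identityʳ m))) (+-monoʳ-≤ m n≤m))

sorted-orders-agree : ∀ {A : Set} {v w : A → ℕ} {o : List A} {x y : A} →
  AllPairs (_<_ on v) o → AllPairs (_<_ on w) o → x ∈ o → y ∈ o → v x < v y → w x < w y
sorted-orders-agree _ _ (here refl) (here refl) vx<vy = ⊥-elim (<-irrefl refl vx<vy)
sorted-orders-agree _ (w-head ∷ _) (here refl) (there y∈o) _ = All.lookup w-head y∈o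
sorted-orders-agree (v-head ∷ _) _ (there x∈o) (here refl) vx<vy =
  ⊥-elim (<-asym vx<vy (All.lookup v-head x∈o))
sorted-orders-agree (_ ∷ vs) (_ ∷ ws) (there x∈o) (there y∈o) vx<vy =
  sorted-orders-agree vs ws x∈o y∈o vx<vy

larger-half : lo ≤ c → c ≤ hi → hi ∸ lo ≤ 2 * (c ∸ lo) ⊎ hi ∸ lo ≤ 2 * (hi ∸ c)
larger-half {lo} {c} {hi} lo≤c c≤hi rewrite ∸-split lo≤c c≤hi =
  m+n≤2*m⊎m+n≤2*n (c ∸ lo) (hi ∸ c)

Sorts : Tree m n → (Elem m n → ℕ) → Set
Sorts t v = IsSortedOrder v (run t v)

Involves : Elem m n → Elem m n → Elem m n → Set
Involves e x y = (e ≟ₑ x) ∨ (e ≟ₑ y) ≡ true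

Constant : (ℕ → Bool) → Set
Constant g = ∀ i j → g i ≡ g j

record Threshold (g : ℕ → Bool) : Set where
  field
    at          : ℕ
    below above : Bool
    below-at    : k < at → g k ≡ below
    above-at    : at ≤ k → g k ≡ above

module _ {x y : Elem m n} {l r : Tree m n} (v : Elem m n → ℕ) where

  run-cmp : ∀ β → (v x <ᵇ v y) ≡ β → run (cmp x y l r) v ≡ run (if β then l else r) v
  run-cmp true  outcome rewrite outcome = refl
  run-cmp false outcome rewrite outcome = refl

  cost-cmp : ∀ e β → (v x <ᵇ v y) ≡ β →
    cost (cmp x y l r) v e
      ≡ (if (e ≟ₑ x) ∨ (e ≟ₑ y) then 1 else 0) + cost (if β then l else r) v e
  cost-cmp e true  outcome rewrite outcome = refl
  cost-cmp e false outcome rewrite outcome = refl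

  cost-branch≤cost-cmp : ∀ e β → (v x <ᵇ v y) ≡ β →
    cost (if β then l else r) v e ≤ cost (cmp x y l r) v e
  cost-branch≤cost-cmp e β outcome rewrite cost-cmp e β outcome = m≤n+m _ _

  cost-cmp-involved : ∀ e β → Involves e x y → (v x <ᵇ v y) ≡ β →
    cost (cmp x y l r) v e ≡ suc (cost (if β then l else r) v e)
  cost-cmp-involved e β involved outcome rewrite cost-cmp e β outcome | involved = refl

run-cong : {v w : Elem m n → ℕ} (t : Tree m n) → v ≗ w → run t v ≡ run t w
run-cong (leaf o)      v≗w = refl
run-cong (cmp x y l r) v≗w rewrite v≗w x | v≗w y | run-cong l v≗w | run-cong r v≗w = refl

cost-cong : {v w : Elem m n → ℕ} (t : Tree m n) → v ≗ w → ∀ e → cost t v e ≡ cost t w e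
cost-cong (leaf o)      v≗w e = refl
cost-cong (cmp x y l r) v≗w e
  rewrite v≗w x | v≗w y | cost-cong l v≗w e | cost-cong r v≗w e = refl

sorts-cong : {v w : Elem m n → ℕ} (t : Tree m n) → v ≗ w → Sorts t v → Sorts t w
sorts-cong t v≗w (sorted , complete) rewrite run-cong t v≗w =
  Linked.map (λ {x} {y} → subst₂ _<_ (v≗w x) (v≗w y)) sorted , complete

module Adversary
  (v : ℕ → Elem m n → ℕ) (e : Elem m n) (M : ℕ)
  (classify : ∀ x y → Constant (λ k → v k x <ᵇ v k y)
                    ⊎ (Involves e x y × Threshold (λ k → v k x <ᵇ v k y)))
  (separated : ∀ {k} → k < M →
               ∀ o → IsSortedOrder (v k) o → IsSortedOrder (v (suc k)) o → ⊥)
  where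

  Expensive : Tree m n → ℕ → ℕ → Set
  Expensive t lo hi = ∃[ k ] (lo ≤ k × k < hi) × hi ∸ lo ≤ 2 ^ cost t (v k) e

  adversary : (t : Tree m n) → lo < hi → hi ≤ suc M →
    (∀ {k} → lo ≤ k → k < hi → Sorts t (v k)) → Expensive t lo hi
  adversary {lo} {hi} (leaf o) lo<hi hi≤1+M sorts with suc lo <? hi
  ... | no  1+lo≮hi =
    lo , (≤-refl , lo<hi) , ≤-trans (∸-monoˡ-≤ lo (≮⇒≥ 1+lo≮hi)) (≤-reflexive (m+n∸n≡m 1 lo))
  ... | yes 1+lo<hi = ⊥-elim (separated (≤-pred (≤-trans 1+lo<hi hi≤1+M)) o
    (sorts ≤-refl (<-trans (n<1+n lo) 1+lo<hi)) (sorts (n≤1+n lo) 1+lo<hi))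
  adversary {lo} {hi} (cmp x y l r) lo<hi hi≤1+M sorts = by-outcome (classify x y)
    where
    g : ℕ → Bool
    g k = v k x <ᵇ v k y

    On : Bool → ℕ → ℕ → Set
    On β lo′ hi′ = ∀ {k} → lo′ ≤ k → k < hi′ → g k ≡ β

    sorts-branch : ∀ β {lo′ hi′} → lo ≤ lo′ → hi′ ≤ hi → On β lo′ hi′ →
      ∀ {k} → lo′ ≤ k → k < hi′ → Sorts (if β then l else r) (v k)
    sorts-branch β lo≤lo′ hi′≤hi on {k} lo′≤k k<hi′ =
      subst (IsSortedOrder (v k)) (run-cmp (v k) β (on lo′≤k k<hi′))
        (sorts (≤-trans lo≤lo′ lo′≤k) (<-≤-trans k<hi′ hi′≤hi))

    descend : ∀ β {lo′ hi′} → lo′ < hi′ → hi′ ≤ suc M →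
      (∀ {k} → lo′ ≤ k → k < hi′ → Sorts (if β then l else r) (v k)) →
      Expensive (if β then l else r) lo′ hi′
    descend true  = adversary l
    descend false = adversary r

    whole : ∀ β → On β lo hi → Expensive (cmp x y l r) lo hi
    whole β on with descend β lo<hi hi≤1+M (sorts-branch β ≤-refl ≤-refl on)
    ... | k , (lo≤k , k<hi) , bound =
      k , (lo≤k , k<hi) ,
      ≤-trans bound (^-monoʳ-≤ 2 (cost-branch≤cost-cmp (v k) e β (on lo≤k k<hi)))

    halve : Involves e x y → ∀ β {lo′ hi′} → lo ≤ lo′ → lo′ < hi′ → hi′ ≤ hi →
      hi ∸ lo ≤ 2 * (hi′ ∸ lo′) → On β lo′ hi′ → Expensive (cmp x y l r) lo hi
    halve involved β {lo′} {hi′} lo≤lo′ lo′<hi′ hi′≤hi size on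
      with descend β lo′<hi′ (≤-trans hi′≤hi hi≤1+M) (sorts-branch β lo≤lo′ hi′≤hi on)
    ... | k , (lo′≤k , k<hi′) , bound =
      k , (≤-trans lo≤lo′ lo′≤k , <-≤-trans k<hi′ hi′≤hi) , (begin
        hi ∸ lo                                     ≤⟨ size ⟩
        2 * (hi′ ∸ lo′)                             ≤⟨ *-monoʳ-≤ 2 bound ⟩
        2 ^ suc (cost (if β then l else r) (v k) e) ≡⟨ cong (2 ^_) (sym charged) ⟩
        2 ^ cost (cmp x y l r) (v k) e              ∎)
      where
      open ≤-Reasoning
      charged = cost-cmp-involved (v k) e β involved (on lo′≤k k<hi′)

    module _ (involved : Involves e x y) (threshold : Threshold g) where
      open Threshold threshold

      by-threshold : Expensive (cmp x y l r) lo hi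
      by-threshold with lo <? at | at <? hi
      ... | no lo≮at  | _         = whole above (λ lo≤k _ → above-at (≤-trans (≮⇒≥ lo≮at) lo≤k))
      ... | yes _     | no at≮hi  = whole below (λ _ k<hi → below-at (<-≤-trans k<hi (≮⇒≥ at≮hi)))
      ... | yes lo<at | yes at<hi with larger-half (<⇒≤ lo<at) (<⇒≤ at<hi)
      ...   | inj₁ left  = halve involved below ≤-refl lo<at (<⇒≤ at<hi) left (λ _ → below-at)
      ...   | inj₂ right = halve involved above (<⇒≤ lo<at) at<hi ≤-refl right (λ at≤k _ → above-at at≤k)

    by-outcome : Constant g ⊎ (Involves e x y × Threshold g) → Expensive (cmp x y l r) lo hi
    by-outcome (inj₁ constant)                = whole (g lo) (λ {k} _ _ → constant k lo)
    by-outcome (inj₂ (involved , threshold)) = by-threshold involved threshold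

odd<odd : k < c → suc (2 * k) < suc (2 * c)
odd<odd k<c = s≤s (*-monoʳ-< 2 k<c)

odd≤odd : k ≤ c → suc (2 * k) ≤ suc (2 * c)
odd≤odd k≤c = s≤s (*-monoʳ-≤ 2 k≤c)

odd<even : k < c → suc (2 * k) < 2 * c
odd<even {k} {c} k<c = subst (_≤ 2 * c) (*-suc 2 k) (*-monoʳ-≤ 2 k<c)

even<odd : c ≤ k → 2 * c < suc (2 * k)
even<odd c≤k = s≤s (*-monoʳ-≤ 2 c≤k)

module Gaps (m n : ℕ) where

  b₀ : Elem m (suc n)
  b₀ = inj₂ Fin.zero

  -- aᵢ = 2(i + 1) and b₀ = 2k + 1, so b₀ lies just below a_k; the other b's
  -- are odd and lie above all of A.
  gap : ℕ → Elem m (suc n) → ℕ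
  gap k (inj₁ i)           = 2 * suc (toℕ i)
  gap k (inj₂ Fin.zero)    = suc (2 * k)
  gap k (inj₂ (Fin.suc j)) = suc (2 * (m + suc (toℕ j)))

  gap-input : k ≤ m → Input m (suc n)
  gap-input {k} k≤m = record
    { valA     = λ i → gap k (inj₁ i)
    ; valB     = λ j → gap k (inj₂ j)
    ; sortedA  = λ i j i<j → *-monoʳ-< 2 (s≤s i<j)
    ; sortedB  = sortedB
    ; distinct = distinct
    }
    where
    sortedB : ∀ i j → i Fin.< j → gap k (inj₂ i) < gap k (inj₂ j)
    sortedB Fin.zero    (Fin.suc j) _   = odd<odd (≤-<-trans k≤m (m<m+n m z<s))
    sortedB (Fin.suc i) (Fin.suc j) i<j = odd<odd (+-monoʳ-< m i<j)

    distinct : ∀ i j → gap k (inj₁ i) ≢ gap k (inj₂ j)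
    distinct i Fin.zero    = even≢odd (suc (toℕ i)) k
    distinct i (Fin.suc j) = even≢odd (suc (toℕ i)) (m + suc (toℕ j))

  val-gap-input : (k≤m : k ≤ m) → ∀ e → val (gap-input k≤m) e ≡ gap k e
  val-gap-input k≤m (inj₁ i) = refl
  val-gap-input k≤m (inj₂ j) = refl

  classify : ∀ x y → Constant (λ k → gap k x <ᵇ gap k y)
                   ⊎ (Involves b₀ x y × Threshold (λ k → gap k x <ᵇ gap k y))
  classify (inj₁ i)           (inj₁ j)           = inj₁ λ _ _ → refl
  classify (inj₁ i)           (inj₂ (Fin.suc j)) = inj₁ λ _ _ → refl
  classify (inj₂ (Fin.suc i)) (inj₁ j)           = inj₁ λ _ _ → refl
  classify (inj₂ (Fin.suc i)) (inj₂ (Fin.suc j)) = inj₁ λ _ _ → refl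
  classify (inj₂ Fin.zero)    (inj₂ Fin.zero)    = inj₂ (refl , record
    { at = 0 ; below = true ; above = false
    ; below-at = λ ()
    ; above-at = λ {k} _ → <ᵇ≡false (≤-refl {2 * k}) })
  classify (inj₂ Fin.zero)    (inj₁ i)           = inj₂ (refl , record
    { at = suc (toℕ i) ; below = true ; above = false
    ; below-at = λ k<at → <ᵇ≡true (odd<even k<at)
    ; above-at = λ at≤k → <ᵇ≡false (<⇒≤ (even<odd at≤k)) })
  classify (inj₁ i)           (inj₂ Fin.zero)    = inj₂ (refl , record
    { at = suc (toℕ i) ; below = false ; above = true
    ; below-at = λ k<at → <ᵇ≡false (<⇒≤ (odd<even k<at))
    ; above-at = λ at≤k → <ᵇ≡true (even<odd at≤k) })
  classify (inj₂ Fin.zero)    (inj₂ (Fin.suc j)) = inj₂ (refl , record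
    { at = m + suc (toℕ j) ; below = true ; above = false
    ; below-at = λ k<at → <ᵇ≡true (odd<odd k<at)
    ; above-at = λ at≤k → <ᵇ≡false (odd≤odd at≤k) })
  classify (inj₂ (Fin.suc j)) (inj₂ Fin.zero)    = inj₂ (refl , record
    { at = suc (m + suc (toℕ j)) ; below = false ; above = true
    ; below-at = λ k<at → <ᵇ≡false (odd≤odd (≤-pred k<at))
    ; above-at = λ at≤k → <ᵇ≡true (odd<odd at≤k) })

  adjacent-gaps-separated : k < m →
    ∀ o → IsSortedOrder (gap k) o → IsSortedOrder (gap (suc k)) o → ⊥
  adjacent-gaps-separated {k} k<m o (sorted , complete) (sorted′ , _) =
    <⇒≱ b₀<aₖ′ (≤-trans (≤-reflexive (cong (λ i → 2 * suc i) toℕaₖ)) (n≤1+n _))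
    where
    aₖ : Elem m (suc n)
    aₖ = inj₁ (fromℕ< k<m)
    toℕaₖ : toℕ (fromℕ< k<m) ≡ k
    toℕaₖ = toℕ-fromℕ< k<m
    b₀<aₖ : gap k b₀ < gap k aₖ
    b₀<aₖ = odd<even (s≤s (≤-reflexive (sym toℕaₖ)))
    b₀<aₖ′ : gap (suc k) b₀ < gap (suc k) aₖ
    b₀<aₖ′ = sorted-orders-agree
      (Linked⇒AllPairs <-trans sorted) (Linked⇒AllPairs <-trans sorted′)
      (complete b₀) (complete aₖ) b₀<aₖ

  open Adversary gap b₀ m classify adjacent-gaps-separated

  merging-is-expensive-for-b₀ : (t : Tree m (suc n)) → Merges t →
    ∃[ I ] suc m ≤ 2 ^ cost t (val I) b₀
  merging-is-expensive-for-b₀ t merges with adversary t z<s ≤-refl sorts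
    where
    sorts : ∀ {k} → 0 ≤ k → k < suc m → Sorts t (gap k)
    sorts _ k<1+m =
      sorts-cong t (val-gap-input (≤-pred k<1+m)) (merges (gap-input (≤-pred k<1+m)))
  ... | k , (_ , k<1+m) , bound =
    gap-input (≤-pred k<1+m) ,
    subst (λ c → suc m ≤ 2 ^ c) (sym (cost-cong t (val-gap-input (≤-pred k<1+m)) b₀)) bound

lemma29 : (m n : ℕ) → 1 ≤ m → 1 ≤ n → (t : Tree m n) → Merges t →
    ∃[ I ] ∃[ e ] ⌊log₂ m ⌋ + 1 ≤ cost t (val I) e
lemma29 (suc m) (suc n) _ _ t merges =
  let I , bound = merging-is-expensive-for-b₀ t merges
  in I , b₀ , subst (_≤ cost t (val I) b₀) (+-comm 1 ⌊log₂ suc m ⌋) (<2^⇒⌊log₂⌋< bound)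
  where open Gaps (suc m) n
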